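{- Let $U$ be a set with at least two elements and let $\varphi,\varphi'$ be partitions on $U$. Then $\lnot\varphi\vee\lnot\varphi'=1$ if and only if $\varphi\mid\varphi'=1$.
   Context: A partition on $U$ is a set of nonempty pairwise disjoint subsets (blocks) with union $U$. $\operatorname{dit}(\pi)$ is the set of ordered pairs $(u,u')\in U\times U$ with $u,u'$ in different blocks of $\pi$; $\operatorname{indit}(\pi)=(U\times U)\setminus\operatorname{dit}(\pi)$. For $S\subseteq U\times U$, $\overline{S}$ is the smallest equivalence relation on $U$ containing $S$, $S^c=(U\times U)\setminus S$, and $\operatorname{int}(S)=(\overline{S^c})^c$, which is always the dit set of a partition. Partitions are identified by their dit sets. $0=\{U\}$ (empty dit set); $1$ is the discrete partition into singletons ($\operatorname{dit}(1)=U\times U\setminus\Delta$, $\Delta$ the diagonal). Operations: $\operatorname{dit}(\sigma\vee\tau)=\operatorname{dit}(\sigma)\cup\operatorname{dit}(\tau)$; $\operatorname{dit}(\sigma\Rightarrow\tau)=\operatorname{int}(\operatorname{dit}(\sigma)^c\cup\operatorname{dit}(\tau))$; $\lnot\sigma=\sigma\Rightarrow 0$; $\operatorname{dit}(\sigma\mid\tau)=\operatorname{int}(\operatorname{indit}(\sigma)\cup\operatorname{indit}(\tau))$. -}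

module Defs where

open import Data.Empty using (⊥)
open import Data.Sum using (_⊎_)
open import Data.Product using (_×_)
open import Relation.Nullary using (¬_)
open import Relation.Binary.PropositionalEquality using (_≡_)
open import Relation.Binary.Structures using (IsEquivalence)

SubRel : Set → Set₁
SubRel U = U → U → Set

module _ {U : Set} where

  _ᶜ : SubRel U → SubRel U
  (S ᶜ) u v = ¬ S u v

  _∪_ : SubRel U → SubRel U → SubRel U
  (S ∪ T) u v = S u v ⊎ T u v

  _≐_ : SubRel U → SubRel U → Set
  S ≐ T = ∀ u v → (S u v → T u v) × (T u v → S u v)

  data EqClosure (S : SubRel U) : U → U → Set where
    inc   : ∀ {u v} → S u v → EqClosure S u v
    refl′ : ∀ {u} → EqClosure S u u
    sym′  : ∀ {u v} → EqClosure S u v → EqClosure S v u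
    trans′ : ∀ {u v w} → EqClosure S u v → EqClosure S v w → EqClosure S u w

  int : SubRel U → SubRel U
  int S = (EqClosure (S ᶜ)) ᶜ

-- A partition on U, given by its "same block" relation (an equivalence
-- relation on U); the blocks are its equivalence classes.
record Partition (U : Set) : Set₁ where
  field
    SameBlock     : U → U → Set
    isEquivalence : IsEquivalence SameBlock

module _ {U : Set} where

  dit : Partition U → SubRel U
  dit π u v = ¬ Partition.SameBlock π u v

  indit : Partition U → SubRel U
  indit π = (dit π) ᶜ

  -- dit sets of the partitions 0 = {U} and 1 (discrete)
  dit0 : SubRel U
  dit0 u v = ⊥

  dit1 : SubRel U
  dit1 u v = ¬ (u ≡ v)

  dit-∨ : SubRel U → SubRel U → SubRel U
  dit-∨ D E = D ∪ E

  dit-⇒ : SubRel U → SubRel U → SubRel U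
  dit-⇒ D E = int ((D ᶜ) ∪ E)

  dit-¬ : SubRel U → SubRel U
  dit-¬ D = dit-⇒ D dit0

  dit-∣ : SubRel U → SubRel U → SubRel U
  dit-∣ D E = int ((D ᶜ) ∪ (E ᶜ))

-- A partition φ with a pair of elements in different blocks has ¬φ = 0:
-- every element is in a different block from one end of that pair, so the
-- equivalence closure of dit(φ) is all of U × U.  Hence, as U has two
-- distinct elements, ¬φ ∨ ¬φ′ = 1 exactly when φ = 0 or φ′ = 0.  On the other
-- side, φ ∣ φ′ = 1 exactly when the same-block relations of φ and φ′ cover
-- U × U, and if two equivalence relations cover U × U then one of them
-- already does: a pair a, b unrelated by R is related by S, and every element
-- is S-related to a or to b.
module Submission where

open import Defs
open import Level using (0ℓ)
open import Axiom.ExcludedMiddle using (ExcludedMiddle)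
open import Axiom.DoubleNegationElimination using (em⇒dne)
open import Data.Empty using (⊥-elim)
open import Data.Product using (∃₂; _,_; proj₂)
open import Data.Sum using (_⊎_; inj₁; inj₂; [_,_]′) renaming (map to ⊎-map)
open import Function.Base using (_∘_; id)
open import Function.Bundles using (_⇔_; mk⇔)
open import Function.Construct.Composition using (_⇔-∘_)
open import Function.Construct.Symmetry using (⇔-sym)
open import Relation.Binary.PropositionalEquality using (_≢_; _≡_; refl; sym; trans)
open import Relation.Binary.Structures using (IsEquivalence)
open import Relation.Nullary using (¬_; yes; no)
open Partition using (SameBlock; isEquivalence)

module _ {U : Set} where

  EqClosure-mono : ∀ {S T : SubRel U} → (∀ {u v} → S u v → T u v) →
                   ∀ {u v} → EqClosure S u v → EqClosure T u v
  EqClosure-mono S⊆T (inc s)      = inc (S⊆T s)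
  EqClosure-mono S⊆T refl′        = refl′
  EqClosure-mono S⊆T (sym′ c)     = sym′ (EqClosure-mono S⊆T c)
  EqClosure-mono S⊆T (trans′ c d) = trans′ (EqClosure-mono S⊆T c) (EqClosure-mono S⊆T d)

  EqClosure-empty : ∀ {S : SubRel U} → (∀ u v → ¬ S u v) →
                    ∀ {u v} → EqClosure S u v → u ≡ v
  EqClosure-empty S-empty (inc s)      = ⊥-elim (S-empty _ _ s)
  EqClosure-empty S-empty refl′        = refl
  EqClosure-empty S-empty (sym′ c)     = sym (EqClosure-empty S-empty c)
  EqClosure-empty S-empty (trans′ c d) = trans (EqClosure-empty S-empty c) (EqClosure-empty S-empty d)

  int⊆dit1 : ∀ {S : SubRel U} {u v} → int S u v → dit1 u v
  int⊆dit1 ¬c refl = ¬c refl′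

  int≐dit1 : ∀ {S : SubRel U} → (∀ u v → ¬ (S ᶜ) u v) → int S ≐ dit1
  int≐dit1 Sᶜ-empty u v = int⊆dit1 , λ u≢v c → u≢v (EqClosure-empty Sᶜ-empty c)

  int≐dit1⁻¹ : ∀ {S : SubRel U} → (∀ u → ¬ (S ᶜ) u u) →
               int S ≐ dit1 → ∀ u v → ¬ (S ᶜ) u v
  int≐dit1⁻¹ irrefl int≐ u v s = proj₂ (int≐ u v) u≢v (inc s)
    where
      u≢v : u ≢ v
      u≢v refl = irrefl u s

  total-of-cover : ∀ {R S : SubRel U} → IsEquivalence R → IsEquivalence S →
                   (∀ u v → R u v ⊎ S u v) → ∀ {a b} → ¬ R a b → ∀ u v → S u v
  total-of-cover {R} {S} isEqR isEqS cover {a} {b} ¬Rab u v = S.trans (S-to-a u) (S.sym (S-to-a v))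
    where
      module R = IsEquivalence isEqR
      module S = IsEquivalence isEqS
      S-of-¬R : ∀ {x y} → ¬ R x y → S x y
      S-of-¬R {x} {y} ¬Rxy = [ ⊥-elim ∘ ¬Rxy , id ]′ (cover x y)
      S-to-a : ∀ x → S x a
      S-to-a x with cover x a
      ... | inj₂ Sxa = Sxa
      ... | inj₁ Rxa = S.trans (S-of-¬R (λ Rxb → ¬Rab (R.trans (R.sym Rxa) Rxb))) (S.sym (S-of-¬R ¬Rab))

  Indiscrete : Partition U → Set
  Indiscrete φ = ∀ u v → SameBlock φ u v

  dit-¬-indiscrete : ∀ {φ : Partition U} → Indiscrete φ → dit-¬ (dit φ) ≐ dit1
  dit-¬-indiscrete φ-0 = int≐dit1 λ u v z → z (inj₁ λ ¬same → ¬same (φ-0 u v))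

  module _ (em : ExcludedMiddle 0ℓ) where

    total-or-counterexample : (R : SubRel U) → (∀ u v → R u v) ⊎ ∃₂ λ u v → ¬ R u v
    total-or-counterexample R with em {∃₂ λ u v → ¬ R u v}
    ... | yes counterexample = inj₂ counterexample
    ... | no none            = inj₁ λ u v → em⇒dne em λ ¬Ruv → none (u , v , ¬Ruv)

    EqClosure-ᶜ-total : ∀ {R : SubRel U} → IsEquivalence R →
                        ∀ {a b} → ¬ R a b → ∀ x y → EqClosure (R ᶜ) x y
    EqClosure-ᶜ-total {R} isEqR {a} {b} ¬Rab x y = trans′ (to-a x) (sym′ (to-a y))
      where
        module R = IsEquivalence isEqR
        to-a : ∀ x → EqClosure (R ᶜ) x a
        to-a x with em {R x a}
        ... | no ¬Rxa = inc ¬Rxa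
        ... | yes Rxa = trans′ (inc (λ Rxb → ¬Rab (R.trans (R.sym Rxa) Rxb))) (sym′ (inc ¬Rab))

    indiscrete-of-dit-¬ : ∀ (φ : Partition U) {a b} → dit-¬ (dit φ) a b → Indiscrete φ
    indiscrete-of-dit-¬ φ {a} {b} ¬φab u v = em⇒dne em λ ¬same →
        ¬φab (EqClosure-mono dit⊆ (EqClosure-ᶜ-total (isEquivalence φ) ¬same a b))
      where
        dit⊆ : ∀ {x y} → dit φ x y → (((dit φ ᶜ) ∪ dit0) ᶜ) x y
        dit⊆ d = [ (λ indit → indit d) , (λ ()) ]′

    dit-∨-¬≐dit1⇔indiscrete : ∀ {a b : U} → a ≢ b → (φ φ′ : Partition U) →
        (dit-∨ (dit-¬ (dit φ)) (dit-¬ (dit φ′)) ≐ dit1) ⇔ (Indiscrete φ ⊎ Indiscrete φ′)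
    dit-∨-¬≐dit1⇔indiscrete {a} {b} a≢b φ φ′ = mk⇔ to from
      where
        to : dit-∨ (dit-¬ (dit φ)) (dit-¬ (dit φ′)) ≐ dit1 → Indiscrete φ ⊎ Indiscrete φ′
        to ¬φ∨¬φ′≐1 = ⊎-map (indiscrete-of-dit-¬ φ) (indiscrete-of-dit-¬ φ′) (proj₂ (¬φ∨¬φ′≐1 a b) a≢b)
        from : Indiscrete φ ⊎ Indiscrete φ′ → dit-∨ (dit-¬ (dit φ)) (dit-¬ (dit φ′)) ≐ dit1
        from (inj₁ φ-0)  u v = [ int⊆dit1 , int⊆dit1 ]′ , λ u≢v → inj₁ (proj₂ (dit-¬-indiscrete {φ} φ-0 u v) u≢v)
        from (inj₂ φ′-0) u v = [ int⊆dit1 , int⊆dit1 ]′ , λ u≢v → inj₂ (proj₂ (dit-¬-indiscrete {φ′} φ′-0 u v) u≢v)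

    dit-∣≐dit1⇔cover : (φ φ′ : Partition U) →
        (dit-∣ (dit φ) (dit φ′) ≐ dit1) ⇔ (∀ u v → SameBlock φ u v ⊎ SameBlock φ′ u v)
    dit-∣≐dit1⇔cover φ φ′ = mk⇔ to from
      where
        to : dit-∣ (dit φ) (dit φ′) ≐ dit1 → ∀ u v → SameBlock φ u v ⊎ SameBlock φ′ u v
        to φ∣φ′≐1 u v with em {SameBlock φ u v}
        ... | yes same = inj₁ same
        ... | no ¬same = inj₂ (em⇒dne em λ ¬same′ →
                int≐dit1⁻¹ irrefl φ∣φ′≐1 u v [ (λ indit → indit ¬same) , (λ indit′ → indit′ ¬same′) ]′)
          where
            irrefl : ∀ w → ¬ (((dit φ ᶜ) ∪ (dit φ′ ᶜ)) ᶜ) w w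
            irrefl w z = z (inj₁ λ ¬same-w → ¬same-w (IsEquivalence.refl (isEquivalence φ)))
        from : (∀ u v → SameBlock φ u v ⊎ SameBlock φ′ u v) → dit-∣ (dit φ) (dit φ′) ≐ dit1
        from cover = int≐dit1 λ u v z → z (⊎-map (λ same ¬same → ¬same same) (λ same ¬same → ¬same same) (cover u v))

    indiscrete⇔cover : (φ φ′ : Partition U) →
        (Indiscrete φ ⊎ Indiscrete φ′) ⇔ (∀ u v → SameBlock φ u v ⊎ SameBlock φ′ u v)
    indiscrete⇔cover φ φ′ = mk⇔ to from
      where
        to : Indiscrete φ ⊎ Indiscrete φ′ → ∀ u v → SameBlock φ u v ⊎ SameBlock φ′ u v
        to (inj₁ φ-0)  u v = inj₁ (φ-0 u v)
        to (inj₂ φ′-0) u v = inj₂ (φ′-0 u v)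
        from : (∀ u v → SameBlock φ u v ⊎ SameBlock φ′ u v) → Indiscrete φ ⊎ Indiscrete φ′
        from cover with total-or-counterexample (SameBlock φ)
        ... | inj₁ φ-0           = inj₁ φ-0
        ... | inj₂ (a , b , ¬ab) = inj₂ (total-of-cover (isEquivalence φ) (isEquivalence φ′) cover ¬ab)

mainTheorem3 : ExcludedMiddle 0ℓ → {U : Set} → (∃₂ λ (a b : U) → a ≢ b) →
    (φ φ′ : Partition U) →
    (dit-∨ (dit-¬ (dit φ)) (dit-¬ (dit φ′)) ≐ dit1) ⇔ (dit-∣ (dit φ) (dit φ′) ≐ dit1)
mainTheorem3 em (a , b , a≢b) φ φ′ =
  ⇔-sym (dit-∣≐dit1⇔cover em φ φ′)
    ⇔-∘ (indiscrete⇔cover em φ φ′ ⇔-∘ dit-∨-¬≐dit1⇔indiscrete em a≢b φ φ′)
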